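{- Let $\mathbb{S}=(\mathbb{F}_q,+,\star)$ be a presemifield of even order $q$, and let $\mathcal{O}=\{(x,f(x)):x\in\mathbb{F}_q\}\cup\{(0),(\infty)\}$ be a hyperoval in $\Pi(\mathbb{S})$, where $f$ is an additive permutation of $\mathbb{F}_q$ with $f(0)=0$. Then the orbit $\{\varphi(\mathcal{O}):\varphi\in\Sigma\}$ consists of exactly $q^2$ hyperovals, and any two distinct hyperovals in this orbit meet in exactly two points, one of which is $(\infty)$.
   Context: A presemifield $(\mathbb{S},+,\star)$ of order $q$ is taken with underlying set $\mathbb{F}_q$, addition the field addition, and a multiplication $\star$ that is left and right distributive with no zero divisors. The plane $\Pi(\mathbb{S})$ has affine points $(a,b)$, points at infinity $(a)$, $a\in\mathbb{F}_q\cup\{\infty\}$, and lines: the line at infinity; $l_a=\{(a,y):y\in\mathbb{F}_q\}\cup\{(\infty)\}$ for $a\in\mathbb{F}_q$; $l_{a,b}=\{(x,y):y=x\star a+b\}\cup\{(a)\}$. A hyperoval is a set of $q+2$ points no three collinear. For $a,b\in\mathbb{F}_q$ the translation $\tau_{a,b}$ maps $(x,y)\mapsto(x+a,y+b)$ and fixes every point at infinity; for $c\in\mathbb{F}_q$ the shear $\sigma_c$ maps $(x,y)\mapsto(x,y+x\star c)$, $(z)\mapsto(z+c)$ for $z\in\mathbb{F}_q$, and $(\infty)\mapsto(\infty)$. $\Sigma$ is the collineation group generated by all $\tau_{a,b}$ and $\sigma_c$ (it consists of the $q^3$ maps $\sigma_c\tau_{a,b}$). -}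

module Defs where

open import Level using (0ℓ)
open import Data.Nat using (ℕ; _+_)
open import Data.Fin using (Fin)
open import Data.Product using (Σ; ∃; _×_; _,_)
open import Data.Sum using (_⊎_)
open import Data.Empty using (⊥)
open import Data.Unit using (⊤)
open import Relation.Nullary using (¬_)
open import Relation.Binary.PropositionalEquality using (_≡_)
open import Algebra.Structures using (IsCommutativeRing)
open import Function.Bundles using (_↔_)
open import Function.Definitions using (Injective)

record FiniteField (q : ℕ) : Set₁ where
  infixl 6 _+F_
  infixl 7 _*F_
  field
    Carrier : Set
    _+F_ _*F_ : Carrier → Carrier → Carrier
    -F_ : Carrier → Carrier
    0F 1F : Carrier
    isCommutativeRing : IsCommutativeRing _≡_ _+F_ _*F_ -F_ 0F 1F
    0≢1 : ¬ (0F ≡ 1F)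
    inverse : ∀ x → ¬ (x ≡ 0F) → Σ Carrier (λ y → x *F y ≡ 1F)
    enumeration : Carrier ↔ Fin q

record IsPresemifield {q : ℕ} (F : FiniteField q)
         (_⋆_ : FiniteField.Carrier F → FiniteField.Carrier F → FiniteField.Carrier F) : Set where
  open FiniteField F
  field
    distribˡ : ∀ x y z → x ⋆ (y +F z) ≡ (x ⋆ y) +F (x ⋆ z)
    distribʳ : ∀ x y z → (y +F z) ⋆ x ≡ (y ⋆ x) +F (z ⋆ x)
    noZeroDivisors : ∀ x y → x ⋆ y ≡ 0F → (x ≡ 0F) ⊎ (y ≡ 0F)

_⇔′_ : Set → Set → Set
A ⇔′ B = (A → B) × (B → A)

module Plane {q : ℕ} (F : FiniteField q)
         (_⋆_ : FiniteField.Carrier F → FiniteField.Carrier F → FiniteField.Carrier F) where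
  open FiniteField F

  data Point : Set where
    aff  : Carrier → Carrier → Point
    inf  : Carrier → Point
    infty : Point

  data Line : Set where
    l∞    : Line
    lvert : Carrier → Line
    lab   : Carrier → Carrier → Line

  _on_ : Point → Line → Set
  aff x y on l∞ = ⊥
  inf z   on l∞ = ⊤
  infty   on l∞ = ⊤
  aff x y on lvert a = x ≡ a
  inf z   on lvert a = ⊥
  infty   on lvert a = ⊤
  aff x y on lab a b = y ≡ (x ⋆ a) +F b
  inf z   on lab a b = z ≡ a
  infty   on lab a b = ⊥

  PointSet : Set₁
  PointSet = Point → Set

  SameSet : PointSet → PointSet → Set
  SameSet S T = ∀ p → S p ⇔′ T p

  HasSize : PointSet → ℕ → Set
  HasSize S n = Σ (Fin n → Point) λ e →
    Injective _≡_ _≡_ e × (∀ p → S p ⇔′ (∃ λ i → e i ≡ p))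

  IsHyperoval : PointSet → Set
  IsHyperoval H = HasSize H (q + 2) ×
    (∀ (L : Line) (p₁ p₂ p₃ : Point) → H p₁ → H p₂ → H p₃ →
       ¬ (p₁ ≡ p₂) → ¬ (p₁ ≡ p₃) → ¬ (p₂ ≡ p₃) →
       p₁ on L → p₂ on L → p₃ on L → ⊥)

  τ : Carrier → Carrier → Point → Point
  τ a b (aff x y) = aff (x +F a) (y +F b)
  τ a b (inf z)   = inf z
  τ a b infty     = infty

  σ : Carrier → Point → Point
  σ c (aff x y) = aff x (y +F (x ⋆ c))
  σ c (inf z)   = inf (z +F c)
  σ c infty     = infty

  -- the element σ_c τ_{a,b} of Σ
  φ : Carrier → Carrier → Carrier → Point → Point
  φ c a b p = σ c (τ a b p)

  Image : (Point → Point) → PointSet → PointSet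
  Image g S p = ∃ λ x → S x × g x ≡ p

  Ovl : (Carrier → Carrier) → PointSet
  Ovl f (aff x y) = y ≡ f x
  Ovl f (inf z)   = z ≡ 0F
  Ovl f infty     = ⊤

  Orb : (Carrier → Carrier) → Carrier × Carrier × Carrier → PointSet
  Orb f (c , a , b) = Image (φ c a b) (Ovl f)

-- The group Σ acts on the plane by collineations, so it maps the hyperoval O to hyperovals.
-- Because f is additive, σ_c τ_{a,b}(O) depends only on the pair (c, b − f a): it is
-- O⟨c, d⟩ = {(x, f x + x ⋆ c + d)} ∪ {(c), (∞)} with d = b − f a.  Reading c off the point
-- at infinity and d off the point with x = 0 shows that distinct pairs give distinct sets,
-- so the orbit has q² members.  Two members O⟨c, d⟩ ≠ O⟨c', d'⟩ share (∞); if c = c' they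
-- share (c) and no affine point, and if c ≠ c' they share no other point at infinity and
-- exactly the affine point with x ⋆ (c − c') = d' − d, since x ↦ x ⋆ (c − c') is an
-- injective, hence bijective, map of the finite set F_q.
module Submission where

open import Defs
open import Data.Nat using (ℕ; _^_)
open import Data.Nat.Divisibility using (_∣_)
open import Data.Fin using (Fin)
open import Data.Product using (Σ; ∃; _×_; _,_)
open import Data.Sum using (_⊎_)
open import Relation.Nullary using (¬_)
open import Relation.Binary.PropositionalEquality using (_≡_)
open import Function.Definitions using (Bijective)

open import Level using (0ℓ)
import Data.Nat as ℕ
open import Data.Nat.Properties using (<-irrefl; *-identityʳ)
open import Data.Fin using (punchOut)
open import Data.Fin.Properties using (any?; _≟_; punchOut-injective; injective⇒≤; *↔×)
open import Data.Product using (proj₁; proj₂)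
open import Data.Product.Function.NonDependent.Propositional using (_×-↔_)
open import Data.Sum using (inj₁; inj₂)
open import Data.Unit using (⊤; tt)
open import Data.Empty using (⊥; ⊥-elim)
open import Relation.Nullary using (yes; no; contradiction)
open import Relation.Nullary.Decidable using (via-injection)
open import Relation.Binary.Definitions using (DecidableEquality)
open import Relation.Binary.PropositionalEquality
  using (refl; sym; trans; cong; cong₂; subst; module ≡-Reasoning)
open import Algebra.Bundles using (CommutativeRing)
import Algebra.Properties.AbelianGroup as AbelianGroupProperties
import Algebra.Solver.CommutativeMonoid as CommutativeMonoidSolver
open import Function.Base using (_∘_)
open import Function.Bundles using (_↔_; Inverse; Injection)
open import Function.Definitions using (Injective)
open import Function.Properties.Inverse using (↔-sym; ↔-trans; ↔⇒↣)
open import Function.Consequences.Propositional using (inverseʳ⇒injective; strictlyInverseʳ⇒inverseʳ)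

injective⇒onto-Fin : ∀ {n} (g : Fin n → Fin n) → Injective _≡_ _≡_ g → ∀ y → ∃ λ x → g x ≡ y
injective⇒onto-Fin {ℕ.suc m} g g-inj y with any? (λ x → g x ≟ y)
... | yes hit = hit
... | no miss = ⊥-elim (<-irrefl refl (injective⇒≤ {f = squeeze} squeeze-inj))
  where
  avoids : ∀ x → ¬ (y ≡ g x)
  avoids x y≡gx = miss (x , sym y≡gx)
  squeeze : Fin (ℕ.suc m) → Fin m
  squeeze x = punchOut (avoids x)
  squeeze-inj : Injective _≡_ _≡_ squeeze
  squeeze-inj e = g-inj (punchOut-injective (avoids _) (avoids _) e)

module _ {A : Set} {n : ℕ} (A↔Fin : A ↔ Fin n) where
  open Inverse A↔Fin using (to; from; strictlyInverseʳ)

  injective⇒onto : (g : A → A) → Injective _≡_ _≡_ g → ∀ y → ∃ λ x → g x ≡ y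
  injective⇒onto g g-inj y with injective⇒onto-Fin (to ∘ g ∘ from) conj-inj (to y)
    where
    conj-inj : Injective _≡_ _≡_ (to ∘ g ∘ from)
    conj-inj = Injection.injective (↔⇒↣ (↔-sym A↔Fin)) ∘ g-inj ∘ Injection.injective (↔⇒↣ A↔Fin)
  ... | i , e = from i , trans (sym (strictlyInverseʳ _)) (trans (cong from e) (strictlyInverseʳ y))

  ×-↔-Fin^2 : (A × A) ↔ Fin (n ^ 2)
  ×-↔-Fin^2 = subst (λ k → (A × A) ↔ Fin (n ℕ.* k)) (sym (*-identityʳ n))
                    (↔-trans (A↔Fin ×-↔ A↔Fin) (↔-sym *↔×))

module PresemifieldPlane {q : ℕ} (F : FiniteField q)
  (_⋆_ : FiniteField.Carrier F → FiniteField.Carrier F → FiniteField.Carrier F)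
  (isPresemifield : IsPresemifield F _⋆_) where

  open FiniteField F
  open IsPresemifield isPresemifield
  open Plane F _⋆_
  open ≡-Reasoning

  commutativeRing : CommutativeRing 0ℓ 0ℓ
  commutativeRing = record { isCommutativeRing = isCommutativeRing }

  open CommutativeRing commutativeRing
    using (+-abelianGroup; +-commutativeMonoid; _-_; +-identityˡ; +-identityʳ; -‿inverseʳ)
  open AbelianGroupProperties +-abelianGroup
    using (∙-cancelˡ; inverseʳ-unique; x≈z//y; //-rightDividesˡ; //-rightDividesʳ; ε⁻¹≈ε;
           x∙y⁻¹≈ε⇒x≈y; x≈y⇒x∙y⁻¹≈ε)
  open CommutativeMonoidSolver +-commutativeMonoid using (solve; _⊜_; _⊕_)

  _≟F_ : DecidableEquality Carrier
  _≟F_ = via-injection (↔⇒↣ enumeration) _≟_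

  Additive : (Carrier → Carrier) → Set
  Additive h = ∀ x y → h (x +F y) ≡ h x +F h y

  module _ {h : Carrier → Carrier} (h-additive : Additive h) where

    additive⇒0↦0 : h 0F ≡ 0F
    additive⇒0↦0 = ∙-cancelˡ (h 0F) (h 0F) 0F (begin
      h 0F +F h 0F  ≡⟨ h-additive 0F 0F ⟨
      h (0F +F 0F)  ≡⟨ cong h (+-identityʳ 0F) ⟩
      h 0F          ≡⟨ +-identityʳ (h 0F) ⟨
      h 0F +F 0F    ∎)

    additive⇒-‿homo : ∀ x → h (-F x) ≡ -F h x
    additive⇒-‿homo x = inverseʳ-unique (h x) (h (-F x)) (begin
      h x +F h (-F x)  ≡⟨ h-additive x (-F x) ⟨
      h (x +F -F x)    ≡⟨ cong h (-‿inverseʳ x) ⟩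
      h 0F             ≡⟨ additive⇒0↦0 ⟩
      0F               ∎)

    additive⇒-homo : ∀ x y → h (x - y) ≡ h x - h y
    additive⇒-homo x y = trans (h-additive x (-F y)) (cong (h x +F_) (additive⇒-‿homo y))

  ⋆-cancelʳ : ∀ {e} → ¬ e ≡ 0F → Injective _≡_ _≡_ (_⋆ e)
  ⋆-cancelʳ {e} e≢0 {w} {u} we≡ue with noZeroDivisors (w - u) e
    (trans (additive⇒-homo (distribʳ e) w u) (x≈y⇒x∙y⁻¹≈ε we≡ue))
  ... | inj₁ w-u≡0 = x∙y⁻¹≈ε⇒x≈y w u w-u≡0
  ... | inj₂ e≡0   = contradiction e≡0 e≢0

  ⋆-onto : ∀ {e} → ¬ e ≡ 0F → ∀ t → ∃ λ u → u ⋆ e ≡ t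
  ⋆-onto {e} e≢0 = injective⇒onto enumeration (_⋆ e) (⋆-cancelʳ e≢0)

  difference-swap : ∀ x y d d' → (x +F d ≡ y +F d') ⇔′ (x - y ≡ d' - d)
  difference-swap x y d d' = forward , backward
    where
    forward : x +F d ≡ y +F d' → x - y ≡ d' - d
    forward eq = begin
      x - y                        ≡⟨ cong (_- y) (x≈z//y x d (y +F d') eq) ⟩
      ((y +F d') - d) - y          ≡⟨ solve 4 (λ y d' -d -y → (((y ⊕ d') ⊕ -d) ⊕ -y) ⊜ ((d' ⊕ -d) ⊕ (y ⊕ -y)))
                                            refl y d' (-F d) (-F y) ⟩
      (d' - d) +F (y - y)          ≡⟨ cong ((d' - d) +F_) (-‿inverseʳ y) ⟩
      (d' - d) +F 0F               ≡⟨ +-identityʳ (d' - d) ⟩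
      d' - d                       ∎
    backward : x - y ≡ d' - d → x +F d ≡ y +F d'
    backward eq = begin
      x +F d                       ≡⟨ cong (_+F d) (//-rightDividesˡ y x) ⟨
      ((x - y) +F y) +F d          ≡⟨ cong (λ t → (t +F y) +F d) eq ⟩
      ((d' - d) +F y) +F d         ≡⟨ solve 4 (λ d' -d y d → (((d' ⊕ -d) ⊕ y) ⊕ d) ⊜ (y ⊕ ((d' ⊕ -d) ⊕ d)))
                                            refl d' (-F d) y d ⟩
      y +F ((d' - d) +F d)         ≡⟨ cong (y +F_) (//-rightDividesˡ d d') ⟩
      y +F d'                      ∎

  unique-crossing : ∀ {c c'} → ¬ c ≡ c' → ∀ d d' →
    ∃ λ u → ∀ w → ((w ⋆ c) +F d ≡ (w ⋆ c') +F d') ⇔′ (w ≡ u)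
  unique-crossing {c} {c'} c≢c' d d' = u , λ w → crosses⇒≡u w , ≡u⇒crosses w
    where
    c-c'≢0 : ¬ c - c' ≡ 0F
    c-c'≢0 = c≢c' ∘ x∙y⁻¹≈ε⇒x≈y c c'
    solution : ∃ λ u → u ⋆ (c - c') ≡ d' - d
    solution = ⋆-onto c-c'≢0 (d' - d)
    u : Carrier
    u = proj₁ solution
    ⋆-slope : ∀ w → w ⋆ (c - c') ≡ (w ⋆ c) - (w ⋆ c')
    ⋆-slope w = additive⇒-homo (distribˡ w) c c'
    crosses⇒≡u : ∀ w → (w ⋆ c) +F d ≡ (w ⋆ c') +F d' → w ≡ u
    crosses⇒≡u w cross = ⋆-cancelʳ c-c'≢0
      (trans (⋆-slope w) (trans (proj₁ (difference-swap _ _ d d') cross) (sym (proj₂ solution))))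
    ≡u⇒crosses : ∀ w → w ≡ u → (w ⋆ c) +F d ≡ (w ⋆ c') +F d'
    ≡u⇒crosses w refl = proj₂ (difference-swap _ _ d d') (trans (sym (⋆-slope u)) (proj₂ solution))

  PullsBackLines : (Point → Point) → Set
  PullsBackLines g = ∀ L → ∃ λ L' → ∀ p → g p on L → p on L'

  ∘-pullsBackLines : ∀ {g h} → PullsBackLines g → PullsBackLines h → PullsBackLines (g ∘ h)
  ∘-pullsBackLines {h = h} g-lines h-lines L with g-lines L
  ... | L₁ , g-pull with h-lines L₁
  ... | L₂ , h-pull = L₂ , λ p incident → h-pull p (g-pull (h p) incident)

  image-isHyperoval : ∀ {S} g → Injective _≡_ _≡_ g → PullsBackLines g →
    IsHyperoval S → IsHyperoval (Image g S)
  image-isHyperoval {S} g g-inj g-lines ((e , e-inj , e-enumerates) , no-three) =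
    (g ∘ e , (λ eq → e-inj (g-inj eq)) , enumerates) , no-three′
    where
    enumerates : ∀ p → Image g S p ⇔′ (∃ λ i → g (e i) ≡ p)
    enumerates p =
      (λ { (x , Sx , gx≡p) → let (i , ei≡x) = proj₁ (e-enumerates x) Sx in i , trans (cong g ei≡x) gx≡p }) ,
      (λ { (i , gei≡p) → e i , proj₂ (e-enumerates (e i)) (i , refl) , gei≡p })
    no-three′ : ∀ L p₁ p₂ p₃ → Image g S p₁ → Image g S p₂ → Image g S p₃ →
      ¬ p₁ ≡ p₂ → ¬ p₁ ≡ p₃ → ¬ p₂ ≡ p₃ → p₁ on L → p₂ on L → p₃ on L → ⊥
    no-three′ L _ _ _ (x₁ , S₁ , refl) (x₂ , S₂ , refl) (x₃ , S₃ , refl) g₁≢g₂ g₁≢g₃ g₂≢g₃ on₁ on₂ on₃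
      with g-lines L
    ... | L′ , pull = no-three L′ x₁ x₂ x₃ S₁ S₂ S₃ (g₁≢g₂ ∘ cong g) (g₁≢g₃ ∘ cong g) (g₂≢g₃ ∘ cong g)
                        (pull x₁ on₁) (pull x₂ on₂) (pull x₃ on₃)

  τ-retraction : ∀ a b p → τ (-F a) (-F b) (τ a b p) ≡ p
  τ-retraction a b (aff x y) = cong₂ aff (//-rightDividesʳ a x) (//-rightDividesʳ b y)
  τ-retraction a b (inf z)   = refl
  τ-retraction a b infty     = refl

  σ-retraction : ∀ c p → σ (-F c) (σ c p) ≡ p
  σ-retraction c (aff x y) =
    cong (aff x) (trans (cong ((y +F (x ⋆ c)) +F_) (additive⇒-‿homo (distribˡ x) c))
                        (//-rightDividesʳ (x ⋆ c) y))
  σ-retraction c (inf z)   = cong inf (//-rightDividesʳ c z)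
  σ-retraction c infty     = refl

  τ-preimage : Carrier → Carrier → Line → Line
  τ-preimage a b l∞        = l∞
  τ-preimage a b (lvert e) = lvert (e - a)
  τ-preimage a b (lab e g) = lab e (((a ⋆ e) +F g) - b)

  τ-pullsBackLines : ∀ a b → PullsBackLines (τ a b)
  τ-pullsBackLines a b L = τ-preimage a b L , on-preimage L
    where
    on-preimage : ∀ L p → τ a b p on L → p on τ-preimage a b L
    on-preimage l∞        (inf z)   _ = tt
    on-preimage l∞        infty     _ = tt
    on-preimage (lvert e) (aff x y) incident = x≈z//y x a e incident
    on-preimage (lvert e) infty     _ = tt
    on-preimage (lab e g) (inf z)   incident = incident
    on-preimage (lab e g) (aff x y) incident = begin
      y                                   ≡⟨ x≈z//y y b _ incident ⟩
      (((x +F a) ⋆ e) +F g) - b           ≡⟨ cong (λ t → (t +F g) - b) (distribʳ e x a) ⟩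
      (((x ⋆ e) +F (a ⋆ e)) +F g) - b     ≡⟨ solve 4 (λ xe ae g -b → (((xe ⊕ ae) ⊕ g) ⊕ -b) ⊜ (xe ⊕ ((ae ⊕ g) ⊕ -b)))
                                                   refl (x ⋆ e) (a ⋆ e) g (-F b) ⟩
      (x ⋆ e) +F (((a ⋆ e) +F g) - b)     ∎

  σ-preimage : Carrier → Line → Line
  σ-preimage c l∞        = l∞
  σ-preimage c (lvert e) = lvert e
  σ-preimage c (lab e g) = lab (e - c) g

  σ-pullsBackLines : ∀ c → PullsBackLines (σ c)
  σ-pullsBackLines c L = σ-preimage c L , on-preimage L
    where
    on-preimage : ∀ L p → σ c p on L → p on σ-preimage c L
    on-preimage l∞        (inf z)   _ = tt
    on-preimage l∞        infty     _ = tt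
    on-preimage (lvert e) (aff x y) incident = incident
    on-preimage (lvert e) infty     _ = tt
    on-preimage (lab e g) (inf z)   incident = x≈z//y z c e incident
    on-preimage (lab e g) (aff x y) incident = begin
      y                                   ≡⟨ x≈z//y y (x ⋆ c) _ incident ⟩
      ((x ⋆ e) +F g) - (x ⋆ c)            ≡⟨ solve 3 (λ xe g -xc → ((xe ⊕ g) ⊕ -xc) ⊜ ((xe ⊕ -xc) ⊕ g))
                                                   refl (x ⋆ e) g (-F (x ⋆ c)) ⟩
      ((x ⋆ e) - (x ⋆ c)) +F g            ≡⟨ cong (_+F g) (additive⇒-homo (distribˡ x) e c) ⟨
      (x ⋆ (e - c)) +F g                  ∎

  φ-image-isHyperoval : ∀ c a b {S} → IsHyperoval S → IsHyperoval (Image (φ c a b) S)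
  φ-image-isHyperoval c a b = image-isHyperoval (φ c a b) φ-injective
    (∘-pullsBackLines (σ-pullsBackLines c) (τ-pullsBackLines a b))
    where
    φ-injective : Injective _≡_ _≡_ (φ c a b)
    φ-injective = inverseʳ⇒injective (φ c a b)
      (strictlyInverseʳ⇒inverseʳ {f⁻¹ = τ (-F a) (-F b) ∘ σ (-F c)} (φ c a b) λ p →
        trans (cong (τ (-F a) (-F b)) (σ-retraction c (τ a b p))) (τ-retraction a b p))

  sameSet-sym : ∀ {S T} → SameSet S T → SameSet T S
  sameSet-sym S≈T p = proj₂ (S≈T p) , proj₁ (S≈T p)

  sameSet-trans : ∀ {S T U} → SameSet S T → SameSet T U → SameSet S U
  sameSet-trans S≈T T≈U p = proj₁ (T≈U p) ∘ proj₁ (S≈T p) , proj₂ (S≈T p) ∘ proj₂ (T≈U p)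

  module Orbit (f : Carrier → Carrier) (f-additive : Additive f) where

    Ovl⟨_⟩ : Carrier × Carrier → PointSet
    Ovl⟨ c , d ⟩ (aff x y) = y ≡ f x +F ((x ⋆ c) +F d)
    Ovl⟨ c , d ⟩ (inf z)   = z ≡ c
    Ovl⟨ c , d ⟩ infty     = ⊤

    key : Carrier × Carrier × Carrier → Carrier × Carrier
    key (c , a , b) = c , b - f a

    Orb≈Ovl⟨key⟩ : ∀ g → SameSet (Orb f g) Ovl⟨ key g ⟩
    Orb≈Ovl⟨key⟩ (c , a , b) p = into p , onto p
      where
      into : ∀ p → Orb f (c , a , b) p → Ovl⟨ c , b - f a ⟩ p
      into _ (aff x _ , refl , refl) = sym (begin
        f (x +F a) +F (((x +F a) ⋆ c) +F (b - f a))
          ≡⟨ cong (_+F (((x +F a) ⋆ c) +F (b - f a))) (f-additive x a) ⟩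
        (f x +F f a) +F (((x +F a) ⋆ c) +F (b - f a))
          ≡⟨ solve 5 (λ fx fa xac b -fa → ((fx ⊕ fa) ⊕ (xac ⊕ (b ⊕ -fa))) ⊜ (((fx ⊕ b) ⊕ xac) ⊕ (fa ⊕ -fa)))
                     refl (f x) (f a) ((x +F a) ⋆ c) b (-F f a) ⟩
        ((f x +F b) +F ((x +F a) ⋆ c)) +F (f a - f a)
          ≡⟨ cong (((f x +F b) +F ((x +F a) ⋆ c)) +F_) (-‿inverseʳ (f a)) ⟩
        ((f x +F b) +F ((x +F a) ⋆ c)) +F 0F
          ≡⟨ +-identityʳ _ ⟩
        (f x +F b) +F ((x +F a) ⋆ c) ∎)
      into _ (inf _ , refl , refl) = +-identityˡ c
      into _ (infty , _ , refl)    = tt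
      onto : ∀ p → Ovl⟨ c , b - f a ⟩ p → Orb f (c , a , b) p
      onto (aff u v) member = aff (u - a) (f (u - a)) , refl , cong₂ aff (//-rightDividesˡ a u) (begin
        (f (u - a) +F b) +F (((u - a) +F a) ⋆ c)
          ≡⟨ cong₂ (λ s t → (s +F b) +F (t ⋆ c)) (additive⇒-homo f-additive u a) (//-rightDividesˡ a u) ⟩
        ((f u - f a) +F b) +F (u ⋆ c)
          ≡⟨ solve 4 (λ fu -fa b uc → (((fu ⊕ -fa) ⊕ b) ⊕ uc) ⊜ (fu ⊕ (uc ⊕ (b ⊕ -fa))))
                     refl (f u) (-F f a) b (u ⋆ c) ⟩
        f u +F ((u ⋆ c) +F (b - f a))
          ≡⟨ member ⟨
        v ∎)
      onto (inf z) z≡c = inf 0F , refl , cong inf (trans (+-identityˡ c) (sym z≡c))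
      onto infty   _   = infty , tt , refl

    Ovl⟨⟩-injective : ∀ k k' → SameSet Ovl⟨ k ⟩ Ovl⟨ k' ⟩ → k ≡ k'
    Ovl⟨⟩-injective (c , d) (c' , d') same = cong₂ _,_ c≡c' d≡d'
      where
      c≡c' : c ≡ c'
      c≡c' = proj₁ (same (inf c)) refl
      above0 : f 0F +F ((0F ⋆ c) +F d) ≡ f 0F +F ((0F ⋆ c') +F d')
      above0 = proj₁ (same (aff 0F _)) refl
      d≡d' : d ≡ d'
      d≡d' = ∙-cancelˡ (0F ⋆ c) d d'
        (trans (∙-cancelˡ (f 0F) _ _ above0) (cong (λ t → (0F ⋆ t) +F d') (sym c≡c')))

    Orb-sameSet⇔key≡ : ∀ g h → SameSet (Orb f g) (Orb f h) ⇔′ (key g ≡ key h)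
    Orb-sameSet⇔key≡ g h =
      (λ same → Ovl⟨⟩-injective (key g) (key h)
                  (sameSet-trans (sameSet-sym (Orb≈Ovl⟨key⟩ g)) (sameSet-trans same (Orb≈Ovl⟨key⟩ h)))) ,
      (λ keys≡ → sameSet-trans (Orb≈Ovl⟨key⟩ g)
                   (sameSet-sym (subst (λ k → SameSet (Orb f h) Ovl⟨ k ⟩) (sym keys≡) (Orb≈Ovl⟨key⟩ h))))

    MeetIn∞And : PointSet → PointSet → Point → Set
    MeetIn∞And S T p = ¬ p ≡ infty × ∀ x → (S x × T x) ⇔′ ((x ≡ infty) ⊎ (x ≡ p))

    Ovl⟨⟩-meet : ∀ k k' → ¬ k ≡ k' → Σ Point (MeetIn∞And Ovl⟨ k ⟩ Ovl⟨ k' ⟩)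
    Ovl⟨⟩-meet (c , d) (c' , d') k≢k' with c ≟F c'
    ... | yes refl = inf c , (λ ()) , λ x → common x , common⁻¹ x
      where
      common : ∀ x → Ovl⟨ c , d ⟩ x × Ovl⟨ c , d' ⟩ x → (x ≡ infty) ⊎ (x ≡ inf c)
      common (aff u v) (in₁ , in₂) =
        contradiction (cong (c ,_) (∙-cancelˡ (u ⋆ c) d d' (∙-cancelˡ (f u) _ _ (trans (sym in₁) in₂)))) k≢k'
      common (inf z)   (z≡c , _) = inj₂ (cong inf z≡c)
      common infty     _         = inj₁ refl
      common⁻¹ : ∀ x → (x ≡ infty) ⊎ (x ≡ inf c) → Ovl⟨ c , d ⟩ x × Ovl⟨ c , d' ⟩ x
      common⁻¹ _ (inj₁ refl) = tt , tt
      common⁻¹ _ (inj₂ refl) = refl , refl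
    ... | no c≢c' = aff u (height u) , (λ ()) , λ x → common x , common⁻¹ x
      where
      height : Carrier → Carrier
      height w = f w +F ((w ⋆ c) +F d)
      crossing : ∃ λ u → ∀ w → ((w ⋆ c) +F d ≡ (w ⋆ c') +F d') ⇔′ (w ≡ u)
      crossing = unique-crossing c≢c' d d'
      u : Carrier
      u = proj₁ crossing
      common : ∀ x → Ovl⟨ c , d ⟩ x × Ovl⟨ c' , d' ⟩ x → (x ≡ infty) ⊎ (x ≡ aff u (height u))
      common (aff w v) (in₁ , in₂) = inj₂ (cong₂ aff w≡u (trans in₁ (cong height w≡u)))
        where
        w≡u : w ≡ u
        w≡u = proj₁ (proj₂ crossing w) (∙-cancelˡ (f w) _ _ (trans (sym in₁) in₂))
      common (inf z)   (z≡c , z≡c') = contradiction (trans (sym z≡c) z≡c') c≢c'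
      common infty     _            = inj₁ refl
      common⁻¹ : ∀ x → (x ≡ infty) ⊎ (x ≡ aff u (height u)) → Ovl⟨ c , d ⟩ x × Ovl⟨ c' , d' ⟩ x
      common⁻¹ _ (inj₁ refl) = tt , tt
      common⁻¹ _ (inj₂ refl) = refl , cong (f u +F_) (proj₂ (proj₂ crossing u) refl)

    Orb-meet : ∀ g h → ¬ SameSet (Orb f g) (Orb f h) → Σ Point (MeetIn∞And (Orb f g) (Orb f h))
    Orb-meet g h distinct with Ovl⟨⟩-meet (key g) (key h) (distinct ∘ proj₂ (Orb-sameSet⇔key≡ g h))
    ... | p , p≢∞ , meet = p , p≢∞ , λ x →
      (λ { (Gx , Hx) → proj₁ (meet x) (proj₁ (Orb≈Ovl⟨key⟩ g x) Gx , proj₁ (Orb≈Ovl⟨key⟩ h x) Hx) }) ,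
      (λ at → let (Gx , Hx) = proj₂ (meet x) at in proj₂ (Orb≈Ovl⟨key⟩ g x) Gx , proj₂ (Orb≈Ovl⟨key⟩ h x) Hx)

    representative : Carrier × Carrier → Carrier × Carrier × Carrier
    representative (c , d) = c , 0F , d

    key∘representative : ∀ k → key (representative k) ≡ k
    key∘representative (c , d) =
      cong (c ,_) (trans (cong (λ t → d +F -F t) (additive⇒0↦0 f-additive))
                         (trans (cong (d +F_) ε⁻¹≈ε) (+-identityʳ d)))

    orbit-enumeration : Σ (Fin (q ^ 2) → Carrier × Carrier × Carrier) λ e →
      (∀ i j → SameSet (Orb f (e i)) (Orb f (e j)) → i ≡ j) × (∀ g → ∃ λ i → SameSet (Orb f g) (Orb f (e i)))
    orbit-enumeration = representative ∘ from , distinct , covers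
      where
      open Inverse (×-↔-Fin^2 enumeration) using (to; from; strictlyInverseʳ)
      from-injective : Injective _≡_ _≡_ from
      from-injective = Injection.injective (↔⇒↣ (↔-sym (×-↔-Fin^2 enumeration)))
      distinct : ∀ i j → SameSet (Orb f (representative (from i))) (Orb f (representative (from j))) → i ≡ j
      distinct i j same = from-injective (begin
        from i                              ≡⟨ key∘representative (from i) ⟨
        key (representative (from i))       ≡⟨ proj₁ (Orb-sameSet⇔key≡ _ _) same ⟩
        key (representative (from j))       ≡⟨ key∘representative (from j) ⟩
        from j                              ∎)
      covers : ∀ g → ∃ λ i → SameSet (Orb f g) (Orb f (representative (from i)))
      covers g = to (key g) , proj₂ (Orb-sameSet⇔key≡ _ _)
        (sym (trans (key∘representative (from (to (key g)))) (strictlyInverseʳ (key g))))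

-- Evenness of q and bijectivity of f are what make O a hyperoval, which is assumed here,
-- and f 0 = 0 already follows from additivity.
lemma5p2 : ∀ {q : ℕ} (F : FiniteField q) → 2 ∣ q →
    (_⋆_ : FiniteField.Carrier F → FiniteField.Carrier F → FiniteField.Carrier F) →
    IsPresemifield F _⋆_ →
    (f : FiniteField.Carrier F → FiniteField.Carrier F) →
    (∀ x y → f (FiniteField._+F_ F x y) ≡ FiniteField._+F_ F (f x) (f y)) →
    Bijective _≡_ _≡_ f →
    f (FiniteField.0F F) ≡ FiniteField.0F F →
    Plane.IsHyperoval F _⋆_ (Plane.Ovl F _⋆_ f) →
    (∀ g → Plane.IsHyperoval F _⋆_ (Plane.Orb F _⋆_ f g))
    × (Σ (Fin (q ^ 2) → FiniteField.Carrier F × FiniteField.Carrier F × FiniteField.Carrier F) λ e →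
         (∀ i j → Plane.SameSet F _⋆_ (Plane.Orb F _⋆_ f (e i)) (Plane.Orb F _⋆_ f (e j)) → i ≡ j)
         × (∀ g → ∃ λ i → Plane.SameSet F _⋆_ (Plane.Orb F _⋆_ f g) (Plane.Orb F _⋆_ f (e i))))
    × (∀ g h → ¬ Plane.SameSet F _⋆_ (Plane.Orb F _⋆_ f g) (Plane.Orb F _⋆_ f h) →
         Σ (Plane.Point F _⋆_) λ p → ¬ (p ≡ Plane.infty) ×
           (∀ x → (Plane.Orb F _⋆_ f g x × Plane.Orb F _⋆_ f h x) ⇔′ ((x ≡ Plane.infty) ⊎ (x ≡ p))))
lemma5p2 F _ _⋆_ isPresemifield f f-additive _ _ O-isHyperoval =
  (λ { (c , a , b) → φ-image-isHyperoval c a b O-isHyperoval }) , orbit-enumeration , Orb-meet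
  where
  open PresemifieldPlane F _⋆_ isPresemifield
  open Orbit f f-additive
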